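{- Let $A$ be a totally ordered alphabet, $F(A)$ the free group on $A$, and $\ell\in A$. If $g\in F(A)$ is a palindrome, then $\lambda_\ell(g)\ell$ is a palindrome and $\ell\rho_\ell(g)$ is a palindrome.
   Context: The reversal $g\mapsto\tilde g$ is the unique anti-automorphism of $F(A)$ with $\tilde a=a$ for all $a\in A$; a palindrome in $F(A)$ is an element $g$ with $\tilde g=g$. For $\ell\in A$, $\lambda_\ell$ and $\rho_\ell$ are the automorphisms of $F(A)$ defined on letters $a\in A$ by: $\lambda_\ell(a)=a\ell^{ -1}$ if $a<\ell$, $\lambda_\ell(\ell)=\ell$, $\lambda_\ell(a)=\ell a$ if $a>\ell$; and $\rho_\ell(a)=a\ell$ if $a<\ell$, $\rho_\ell(\ell)=\ell$, $\rho_\ell(a)=\ell^{ -1}a$ if $a>\ell$. -}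

module Defs where

open import Data.List using (List; []; _∷_; _++_; reverse; map; concatMap)
open import Relation.Binary using (Rel; IsStrictTotalOrder; Tri; tri<; tri≈; tri>)
open import Level using (0ℓ)
open import Relation.Binary.PropositionalEquality using (_≡_)
open import Relation.Binary.Construct.Closure.Equivalence using (EqClosure)

data Lit (A : Set) : Set where
  pos : A → Lit A
  neg : A → Lit A

invLit : {A : Set} → Lit A → Lit A
invLit (pos a) = neg a
invLit (neg a) = pos a

-- Words over A ∪ A⁻¹ represent elements of F(A).
Word : Set → Set
Word A = List (Lit A)

data _⟶_ {A : Set} : Word A → Word A → Set where
  cancel : (u v : Word A) (x : Lit A) → (u ++ x ∷ invLit x ∷ v) ⟶ (u ++ v)

-- Equality in F(A): equivalence closure of free reduction.
_≈F_ : {A : Set} → Word A → Word A → Set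
_≈F_ = EqClosure _⟶_

invW : {A : Set} → Word A → Word A
invW w = reverse (map invLit w)

-- Reversal anti-automorphism g ↦ g̃ (fixes each a ∈ A, hence also a⁻¹).
rev : {A : Set} → Word A → Word A
rev = reverse

Palindrome : {A : Set} → Word A → Set
Palindrome g = rev g ≈F g

extend : {A : Set} → (A → Word A) → Word A → Word A
extend f = concatMap (λ { (pos a) → f a ; (neg a) → invW (f a) })

module _ {A : Set} {_<_ : Rel A 0ℓ} (ord : IsStrictTotalOrder _≡_ _<_) where
  open IsStrictTotalOrder ord using (compare)

  lamGen : A → A → Word A
  lamGen ℓ a with compare a ℓ
  ... | tri< _ _ _ = pos a ∷ neg ℓ ∷ []
  ... | tri≈ _ _ _ = pos ℓ ∷ []
  ... | tri> _ _ _ = pos ℓ ∷ pos a ∷ []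

  rhoGen : A → A → Word A
  rhoGen ℓ a with compare a ℓ
  ... | tri< _ _ _ = pos a ∷ pos ℓ ∷ []
  ... | tri≈ _ _ _ = pos ℓ ∷ []
  ... | tri> _ _ _ = neg ℓ ∷ pos a ∷ []

  lam : A → Word A → Word A
  lam ℓ = extend (lamGen ℓ)

  rho : A → Word A → Word A
  rho ℓ = extend (rhoGen ℓ)

-- For a homomorphism φ of F(A), reversal and φ commute up to a fixed conjugation as soon as
-- they do so on single letters: if ~φ(x) = c φ(x) c⁻¹ for every letter x, then
-- ~φ(g) = c φ(~g) c⁻¹ for every g, because the conjugation by c is itself a homomorphism
-- while reversal is an anti-homomorphism.  For λ_ℓ the letter check holds with c = ℓ⁻¹
-- (e.g. ~(aℓ⁻¹) = ℓ⁻¹a = ℓ⁻¹(aℓ⁻¹)ℓ), for ρ_ℓ with c = ℓ.  Hence for a palindrome g,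
-- ~λ_ℓ(g) = ℓ⁻¹λ_ℓ(g)ℓ, i.e. λ_ℓ(g)ℓ is a palindrome; likewise ~ρ_ℓ(g) = ℓρ_ℓ(g)ℓ⁻¹.
module Submission where

open import Defs
open import Data.List using ([]; _∷_; _++_; [_]; reverse; map)
open import Data.List.Properties using (++-assoc; reverse-++; ++-identityʳ; unfold-reverse)
open import Data.Product using (_×_; _,_)
open import Relation.Binary using (Rel; IsStrictTotalOrder; tri<; tri≈; tri>)
open import Relation.Binary.PropositionalEquality using (_≡_; refl; sym; trans; cong; subst; subst₂; module ≡-Reasoning)
open import Relation.Binary.Construct.Closure.ReflexiveTransitive using (ε)
import Relation.Binary.Construct.Closure.Equivalence as EqClosure
import Relation.Binary.Reasoning.Setoid as SetoidReasoning
open import Level using (0ℓ)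

module ≈F-Reasoning {A : Set} = SetoidReasoning (EqClosure.setoid (_⟶_ {A}))

module _ {A : Set} where

  invLit-involutive : (x : Lit A) → invLit (invLit x) ≡ x
  invLit-involutive (pos a) = refl
  invLit-involutive (neg a) = refl

  ≈F-sym : {u v : Word A} → u ≈F v → v ≈F u
  ≈F-sym = EqClosure.symmetric _⟶_

  ≈F-cancel : (u v : Word A) (x : Lit A) → (u ++ x ∷ invLit x ∷ v) ≈F (u ++ v)
  ≈F-cancel u v x = EqClosure.return (cancel u v x)

  ≈F-cancel′ : (u v : Word A) (x : Lit A) → (u ++ invLit x ∷ x ∷ v) ≈F (u ++ v)
  ≈F-cancel′ u v x =
    subst (λ y → (u ++ invLit x ∷ y ∷ v) ≈F (u ++ v)) (invLit-involutive x) (≈F-cancel u v (invLit x))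

  ⟶-++ˡ : (p : Word A) {u v : Word A} → u ⟶ v → (p ++ u) ⟶ (p ++ v)
  ⟶-++ˡ p (cancel u v x) = subst₂ _⟶_ (++-assoc p u _) (++-assoc p u v) (cancel (p ++ u) v x)

  ⟶-++ʳ : (q : Word A) {u v : Word A} → u ⟶ v → (u ++ q) ⟶ (v ++ q)
  ⟶-++ʳ q (cancel u v x) =
    subst₂ _⟶_ (sym (++-assoc u (x ∷ invLit x ∷ v) q)) (sym (++-assoc u v q)) (cancel u (v ++ q) x)

  ≈F-++ˡ : (p : Word A) {u v : Word A} → u ≈F v → (p ++ u) ≈F (p ++ v)
  ≈F-++ˡ p = EqClosure.gmap (p ++_) (⟶-++ˡ p)

  ≈F-++ʳ : (q : Word A) {u v : Word A} → u ≈F v → (u ++ q) ≈F (v ++ q)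
  ≈F-++ʳ q = EqClosure.gmap (_++ q) (⟶-++ʳ q)

  invW-∷ : (x : Lit A) (w : Word A) → invW (x ∷ w) ≡ invW w ++ [ invLit x ]
  invW-∷ x w = unfold-reverse (invLit x) (map invLit w)

  ++-invW : (w : Word A) → (w ++ invW w) ≈F []
  ++-invW [] = ε
  ++-invW (x ∷ w) = begin
    x ∷ w ++ invW (x ∷ w)               ≡⟨ cong (λ t → x ∷ w ++ t) (invW-∷ x w) ⟩
    x ∷ w ++ invW w ++ [ invLit x ]     ≡⟨ cong (x ∷_) (++-assoc w (invW w) _) ⟨
    x ∷ (w ++ invW w) ++ [ invLit x ]   ≈⟨ ≈F-++ˡ [ x ] (≈F-++ʳ [ invLit x ] (++-invW w)) ⟩
    x ∷ invLit x ∷ []                   ≈⟨ ≈F-cancel [] [] x ⟩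
    [] ∎
    where open ≈F-Reasoning

  invW-++ : (w : Word A) → (invW w ++ w) ≈F []
  invW-++ [] = ε
  invW-++ (x ∷ w) = begin
    invW (x ∷ w) ++ x ∷ w                          ≡⟨ cong (_++ x ∷ w) (invW-∷ x w) ⟩
    (invW w ++ [ invLit x ]) ++ x ∷ w              ≡⟨ ++-assoc (invW w) _ _ ⟩
    invW w ++ invLit x ∷ x ∷ w                     ≈⟨ ≈F-cancel′ (invW w) w x ⟩
    invW w ++ w                                    ≈⟨ invW-++ w ⟩
    [] ∎
    where open ≈F-Reasoning

  palindrome-++-[x] : (x : Lit A) (w : Word A) →
                      reverse w ≈F (invLit x ∷ w ++ [ x ]) → Palindrome (w ++ [ x ])
  palindrome-++-[x] x w rev-w = begin
    reverse (w ++ [ x ])            ≡⟨ reverse-++ w [ x ] ⟩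
    x ∷ reverse w                   ≈⟨ ≈F-++ˡ [ x ] rev-w ⟩
    x ∷ invLit x ∷ w ++ [ x ]       ≈⟨ ≈F-cancel [] _ x ⟩
    w ++ [ x ] ∎
    where open ≈F-Reasoning

  palindrome-x∷ : (x : Lit A) (w : Word A) →
                  reverse w ≈F (x ∷ w ++ [ invLit x ]) → Palindrome (x ∷ w)
  palindrome-x∷ x w rev-w = begin
    reverse (x ∷ w)                                   ≡⟨ unfold-reverse x w ⟩
    reverse w ++ [ x ]                                ≈⟨ ≈F-++ʳ [ x ] rev-w ⟩
    (x ∷ w ++ [ invLit x ]) ++ [ x ]                  ≡⟨ cong (x ∷_) (++-assoc w _ _) ⟩
    (x ∷ w) ++ invLit x ∷ x ∷ []                      ≈⟨ ≈F-cancel′ (x ∷ w) [] x ⟩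
    (x ∷ w) ++ []                                     ≡⟨ ++-identityʳ (x ∷ w) ⟩
    x ∷ w ∎
    where open ≈F-Reasoning

  module _ (f : A → Word A) where

    extendLit : Lit A → Word A
    extendLit (pos a) = f a
    extendLit (neg a) = invW (f a)

    extend-∷ : (x : Lit A) (w : Word A) → extend f (x ∷ w) ≡ extendLit x ++ extend f w
    extend-∷ (pos a) w = refl
    extend-∷ (neg a) w = refl

    extend-++ : (u v : Word A) → extend f (u ++ v) ≡ extend f u ++ extend f v
    extend-++ [] v = refl
    extend-++ (x ∷ u) v = begin
      extend f (x ∷ u ++ v)                        ≡⟨ extend-∷ x (u ++ v) ⟩
      extendLit x ++ extend f (u ++ v)             ≡⟨ cong (extendLit x ++_) (extend-++ u v) ⟩
      extendLit x ++ extend f u ++ extend f v      ≡⟨ ++-assoc (extendLit x) _ _ ⟨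
      (extendLit x ++ extend f u) ++ extend f v    ≡⟨ cong (_++ extend f v) (extend-∷ x u) ⟨
      extend f (x ∷ u) ++ extend f v ∎
      where open ≡-Reasoning

    extend-[x] : (x : Lit A) → extend f [ x ] ≡ extendLit x
    extend-[x] x = trans (extend-∷ x []) (++-identityʳ (extendLit x))

    extendLit-invLit : (x : Lit A) → (extendLit x ++ extendLit (invLit x)) ≈F []
    extendLit-invLit (pos a) = ++-invW (f a)
    extendLit-invLit (neg a) = invW-++ (f a)

    extend-⟶ : {u v : Word A} → u ⟶ v → extend f u ≈F extend f v
    extend-⟶ (cancel u v x) = begin
      extend f (u ++ x ∷ invLit x ∷ v)
        ≡⟨ extend-++ u _ ⟩
      extend f u ++ extend f (x ∷ invLit x ∷ v)
        ≡⟨ cong (extend f u ++_) (trans (extend-∷ x (invLit x ∷ v)) (cong (extendLit x ++_) (extend-∷ (invLit x) v))) ⟩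
      extend f u ++ extendLit x ++ extendLit (invLit x) ++ extend f v
        ≡⟨ cong (extend f u ++_) (++-assoc (extendLit x) _ _) ⟨
      extend f u ++ (extendLit x ++ extendLit (invLit x)) ++ extend f v
        ≈⟨ ≈F-++ˡ (extend f u) (≈F-++ʳ (extend f v) (extendLit-invLit x)) ⟩
      extend f u ++ extend f v
        ≡⟨ extend-++ u v ⟨
      extend f (u ++ v) ∎
      where open ≈F-Reasoning

    extend-resp-≈F : {u v : Word A} → u ≈F v → extend f u ≈F extend f v
    extend-resp-≈F = EqClosure.gfold (EqClosure.isEquivalence _⟶_) (extend f) extend-⟶

    module _ (c : Lit A)
             (reverse-extendLit : (x : Lit A) → reverse (extendLit x) ≈F (c ∷ extendLit x ++ [ invLit c ]))
             where

      reverse-extend : (g : Word A) → reverse (extend f g) ≈F (c ∷ extend f (reverse g) ++ [ invLit c ])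
      reverse-extend [] = ≈F-sym (≈F-cancel [] [] c)
      reverse-extend (x ∷ g) = begin
        reverse (extend f (x ∷ g))
          ≡⟨ cong reverse (extend-∷ x g) ⟩
        reverse (extendLit x ++ extend f g)
          ≡⟨ reverse-++ (extendLit x) (extend f g) ⟩
        reverse (extend f g) ++ reverse (extendLit x)
          ≈⟨ ≈F-++ʳ _ (reverse-extend g) ⟩
        (c ∷ g′ ++ [ invLit c ]) ++ reverse (extendLit x)
          ≈⟨ ≈F-++ˡ (c ∷ g′ ++ [ invLit c ]) (reverse-extendLit x) ⟩
        (c ∷ g′ ++ [ invLit c ]) ++ c ∷ extendLit x ++ [ invLit c ]
          ≡⟨ cong (c ∷_) (++-assoc g′ [ invLit c ] _) ⟩
        (c ∷ g′) ++ invLit c ∷ c ∷ extendLit x ++ [ invLit c ]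
          ≈⟨ ≈F-cancel′ (c ∷ g′) _ c ⟩
        c ∷ g′ ++ extendLit x ++ [ invLit c ]
          ≡⟨ cong (c ∷_) (++-assoc g′ (extendLit x) _) ⟨
        c ∷ (g′ ++ extendLit x) ++ [ invLit c ]
          ≡⟨ cong (λ t → c ∷ (g′ ++ t) ++ [ invLit c ]) (extend-[x] x) ⟨
        c ∷ (g′ ++ extend f [ x ]) ++ [ invLit c ]
          ≡⟨ cong (λ t → c ∷ t ++ [ invLit c ]) (extend-++ (reverse g) [ x ]) ⟨
        c ∷ extend f (reverse g ++ [ x ]) ++ [ invLit c ]
          ≡⟨ cong (λ t → c ∷ extend f t ++ [ invLit c ]) (unfold-reverse x g) ⟨
        c ∷ extend f (reverse (x ∷ g)) ++ [ invLit c ] ∎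
        where
        open ≈F-Reasoning

        g′ : Word A
        g′ = extend f (reverse g)

      palindrome⇒reverse-extend : (g : Word A) → Palindrome g →
                                  reverse (extend f g) ≈F (c ∷ extend f g ++ [ invLit c ])
      palindrome⇒reverse-extend g g-pal =
        EqClosure.transitive _⟶_ (reverse-extend g)
          (≈F-++ˡ [ c ] (≈F-++ʳ [ invLit c ] (extend-resp-≈F g-pal)))

module _ {A : Set} {_<_ : Rel A 0ℓ} (ord : IsStrictTotalOrder _≡_ _<_) (ℓ : A) where
  open IsStrictTotalOrder ord using (compare)

  reverse-lamLit : (x : Lit A) →
                   reverse (extendLit (lamGen ord ℓ) x) ≈F (neg ℓ ∷ extendLit (lamGen ord ℓ) x ++ [ pos ℓ ])
  reverse-lamLit (pos a) with compare a ℓ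
  ... | tri< _ _ _ = ≈F-sym (≈F-cancel (neg ℓ ∷ pos a ∷ []) [] (neg ℓ))
  ... | tri≈ _ _ _ = ≈F-sym (≈F-cancel [] [ pos ℓ ] (neg ℓ))
  ... | tri> _ _ _ = ≈F-sym (≈F-cancel [] (pos a ∷ pos ℓ ∷ []) (neg ℓ))
  reverse-lamLit (neg a) with compare a ℓ
  ... | tri< _ _ _ = ≈F-sym (≈F-cancel [] (neg a ∷ pos ℓ ∷ []) (neg ℓ))
  ... | tri≈ _ _ _ = ≈F-sym (≈F-cancel [ neg ℓ ] [] (neg ℓ))
  ... | tri> _ _ _ = ≈F-sym (≈F-cancel (neg ℓ ∷ neg a ∷ []) [] (neg ℓ))

  reverse-rhoLit : (x : Lit A) →
                   reverse (extendLit (rhoGen ord ℓ) x) ≈F (pos ℓ ∷ extendLit (rhoGen ord ℓ) x ++ [ neg ℓ ])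
  reverse-rhoLit (pos a) with compare a ℓ
  ... | tri< _ _ _ = ≈F-sym (≈F-cancel (pos ℓ ∷ pos a ∷ []) [] (pos ℓ))
  ... | tri≈ _ _ _ = ≈F-sym (≈F-cancel [ pos ℓ ] [] (pos ℓ))
  ... | tri> _ _ _ = ≈F-sym (≈F-cancel [] (pos a ∷ neg ℓ ∷ []) (pos ℓ))
  reverse-rhoLit (neg a) with compare a ℓ
  ... | tri< _ _ _ = ≈F-sym (≈F-cancel [] (neg a ∷ neg ℓ ∷ []) (pos ℓ))
  ... | tri≈ _ _ _ = ≈F-sym (≈F-cancel [] [ neg ℓ ] (pos ℓ))
  ... | tri> _ _ _ = ≈F-sym (≈F-cancel (pos ℓ ∷ neg a ∷ []) [] (pos ℓ))

lemma5 : {A : Set} {_<_ : Rel A 0ℓ} (ord : IsStrictTotalOrder _≡_ _<_)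
         (ℓ : A) (g : Word A) → Palindrome g →
         Palindrome (lam ord ℓ g ++ pos ℓ ∷ [])
           × Palindrome (pos ℓ ∷ rho ord ℓ g)
lemma5 ord ℓ g g-pal =
    palindrome-++-[x] (pos ℓ) (lam ord ℓ g)
      (palindrome⇒reverse-extend (lamGen ord ℓ) (neg ℓ) (reverse-lamLit ord ℓ) g g-pal)
  , palindrome-x∷ (pos ℓ) (rho ord ℓ g)
      (palindrome⇒reverse-extend (rhoGen ord ℓ) (pos ℓ) (reverse-rhoLit ord ℓ) g g-pal)
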